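{- Let $G$ be a graph, let $F$ be any forest of $G$, and let $e_1,\ldots,e_h$ be the edges of $G$ not in $F$ (with their reference orientations). Let $\alpha_1,\ldots,\alpha_h$ be real weights that are generic in the sense that $\sum_{e_i\in C}\operatorname{sign}(C,e_i)\alpha_i\neq0$ for every cycle $C$. Orient each cycle $C$ of $G$ so that $\sum_{e_i\in C}\operatorname{sign}(C,e_i)\alpha_i>0$. Then the resulting cycle orientation configuration is geometric.
   Context: Graphs are finite and connected, possibly with parallel edges but without loops; cycles are simple. Each edge has a fixed reference orientation; for an oriented cycle $C$ and $e\in C$, $\operatorname{sign}(C,e)=\pm1$ according as $C$ traverses $e$ along or against its reference orientation, and $C$ is identified with $\sum_{e\in C}\operatorname{sign}(C,e)e$ in the real vector space $C_1(G,\mathbb{R})$ with orthonormal basis $E(G)$; $H_1(G,\mathbb{R})$ is the span of the cycles. A cycle orientation configuration assigns an orientation to each cycle; it is geometric if there exists $\mathbf{w}\in H_1(G,\mathbb{R})$ with $\langle\mathbf{w},C\rangle>0$ for each cycle $C$ oriented as in the configuration (equivalently, no nontrivial nonnegative integer combination of the oriented cycles is $0$). -}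

module Defs where

open import Level using (Level; _⊔_) renaming (suc to lsuc)
open import Data.Nat using (ℕ; _≤_)
open import Data.Fin using (Fin; zero; suc; _≟_)
open import Data.Bool using (Bool; true; false; if_then_else_)
open import Data.List using (List; []; _∷_; map; length)
open import Data.List.Relation.Unary.All using (All)
open import Data.List.Relation.Unary.Unique.Propositional using (Unique)
open import Data.Product using (Σ; ∃; _×_; _,_; proj₁; proj₂)
open import Relation.Nullary using (¬_; does)
open import Relation.Binary.PropositionalEquality using (_≡_; _≢_)
open import Relation.Binary.Structures using (IsStrictTotalOrder)
open import Algebra.Bundles using (CommutativeRing)

-- Ordered fields (the stdlib has no real numbers; ℝ is one instance).

record OrderedField (c ℓ : Level) : Set (lsuc (c ⊔ ℓ)) where
  field
    commRing : CommutativeRing c ℓ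
  open CommutativeRing commRing public
  field
    _<_               : Carrier → Carrier → Set ℓ
    isStrictTotalOrder : IsStrictTotalOrder _≈_ _<_
    +-mono-<          : ∀ {x y} z → x < y → (x + z) < (y + z)
    *-pos             : ∀ {x y} → 0# < x → 0# < y → 0# < (x * y)
    0≉1               : ¬ (0# ≈ 1#)
    inverse           : ∀ x → ¬ (x ≈ 0#) → Σ Carrier (λ y → (x * y) ≈ 1#)

-- Finite graphs with parallel edges, no loops; each edge e has a
-- reference orientation src e → tgt e.

-- a step of a walk: an edge together with the direction in which it is
-- traversed (true = along its reference orientation)
Step : ℕ → Set
Step m = Fin m × Bool

record Multigraph : Set where
  field
    nV     : ℕ
    nE     : ℕ
    src    : Fin nE → Fin nV
    tgt    : Fin nE → Fin nV
    noLoop : ∀ e → src e ≢ tgt e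

  stepTail : Step nE → Fin nV
  stepTail (e , true)  = src e
  stepTail (e , false) = tgt e

  stepHead : Step nE → Fin nV
  stepHead (e , true)  = tgt e
  stepHead (e , false) = src e

  data Walk : Fin nV → List (Step nE) → Fin nV → Set where
    nil  : ∀ {u} → Walk u [] u
    cons : ∀ {s ss v} → Walk (stepHead s) ss v → Walk (stepTail s) (s ∷ ss) v

  Connected : Set
  Connected = ∀ u v → ∃ λ ss → Walk u ss v

  record Cycle : Set where
    field
      steps     : List (Step nE)
      nontriv   : 2 ≤ length steps
      base      : Fin nV
      closed    : Walk base steps base
      distinctV : Unique (map stepTail steps)
      distinctE : Unique (map proj₁ steps)

  IsForest : (Fin nE → Bool) → Set
  IsForest F = ∀ (C : Cycle) → ¬ All (λ s → F (proj₁ s) ≡ true) (Cycle.steps C)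

module OverField {c ℓ} (K : OrderedField c ℓ) (G : Multigraph) where
  open OrderedField K hiding (zero)
  open Multigraph G

  sumFin : ∀ {k} → (Fin k → Carrier) → Carrier
  sumFin {ℕ.zero}  f = 0#
  sumFin {ℕ.suc k} f = f zero + sumFin (λ i → f (suc i))

  sumList : ∀ {a} {A : Set a} → (A → Carrier) → List A → Carrier
  sumList f []       = 0#
  sumList f (x ∷ xs) = f x + sumList f xs

  signK : Bool → Carrier
  signK true  = 1#
  signK false = - 1#

  -- the oriented cycle C as the vector Σ_{e∈C} sign(C,e) e in C₁(G,K)
  cycleVec : Cycle → Fin nE → Carrier
  cycleVec C e = sumList (λ s → if does (proj₁ s ≟ e) then signK (proj₂ s) else 0#)
                         (Cycle.steps C)

  ⟨_,_⟩ : (Fin nE → Carrier) → (Fin nE → Carrier) → Carrier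
  ⟨ v , w ⟩ = sumFin (λ e → v e * w e)

  InH₁ : (Fin nE → Carrier) → Set (c ⊔ ℓ)
  InH₁ w = ∃ λ (cs : List (Carrier × Cycle)) →
             ∀ e → w e ≈ sumList (λ p → proj₁ p * cycleVec (proj₂ p) e) cs

  Geometric : (Cycle → Set ℓ) → Set (c ⊔ ℓ)
  Geometric Chosen = ∃ λ (w : Fin nE → Carrier) →
    InH₁ w × (∀ C → Chosen C → 0# < ⟨ w , cycleVec C ⟩)

  offForestWeight : (Fin nE → Bool) → (Fin nE → Carrier) → Cycle → Carrier
  offForestWeight F α C =
    sumList (λ s → if F (proj₁ s) then 0# else signK (proj₂ s) * α (proj₁ s))
            (Cycle.steps C)

module Submission where

-- Extend α by zero on the forest edges to a vector ᾱ of
-- C₁(G,K); then ⟨ᾱ, C⟩ is exactly Σ_{eᵢ∈C} sign(C,eᵢ)αᵢ for every oriented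
-- cycle C.  Let w be the orthogonal projection of ᾱ onto H₁(G,K), the span
-- of the cycles.  As ᾱ - w is orthogonal to every cycle, ⟨w, C⟩ = ⟨ᾱ, C⟩,
-- so w ∈ H₁ is positive on exactly the cycles chosen by the configuration.

open import Level using (Level)
open import Data.Nat using (ℕ; zero; suc; _≤_; _≤?_; s≤s)
open import Data.Fin using (Fin; zero; suc)
import Data.Fin as Fin
import Data.Fin.Properties as FinP
open import Data.Bool using (Bool; true; false; if_then_else_)
open import Data.Product using (Σ; _×_; _,_; proj₁; proj₂)
open import Data.Sum using (_⊎_; inj₁; inj₂)
open import Data.Empty using (⊥-elim)
open import Data.Maybe using (Maybe; just; nothing)
import Data.Maybe.Relation.Unary.Any as MaybeAny
open import Data.List using (List; []; _∷_; length; map; concatMap; lookup; tabulate; mapMaybe; cartesianProduct; allFin)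
open import Data.List.Properties using (length-map)
import Data.List.Relation.Unary.All as AllP
open import Data.List.Relation.Unary.Any as Any using (Any; here; there; index)
import Data.List.Relation.Unary.Any.Properties as AnyP
open import Data.List.Relation.Unary.Any.Properties using (lookup-index)
open import Data.List.Relation.Unary.AllPairs using (_∷_)
open import Data.List.Relation.Unary.Unique.Propositional using (Unique)
import Data.List.Relation.Unary.Unique.DecPropositional as DecUnique
open import Data.List.Membership.Propositional using (_∈_)
open import Data.List.Membership.Propositional.Properties using (∈-map⁺; ∈-concat⁺′; ∈-allFin; ∈-cartesianProduct⁺; ∈-lookup)
open import Data.Vec.Functional using (Vector; head; tail)
import Data.Vec.Functional as Vec
import Data.Vec.Functional.Relation.Binary.Equality.Setoid as VecEquality
open import Relation.Nullary using (¬_; Dec; yes; no; does)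
open import Relation.Nullary.Decidable using (map′; _×-dec_)
open import Relation.Binary.Structures using (IsStrictTotalOrder)
open import Relation.Binary.Definitions using (tri<; tri≈; tri>)
open import Relation.Binary.PropositionalEquality as ≡ using (_≡_)
open import Function using (_∘_)
import Relation.Binary.Reasoning.Setoid as SetoidReasoning
import Algebra.Properties.Ring as RingProperties
import Algebra.Properties.Semiring.Sum as SemiringSum
open import Defs

module OrderedFieldFacts {c ℓ} (K : OrderedField c ℓ) where
  open OrderedField K hiding (zero)
  open SemiringSum semiring using (sum)
  open RingProperties ring using (-‿distribˡ-*; -‿distribʳ-*; -‿involutive)
  private module Order = IsStrictTotalOrder isStrictTotalOrder

  NonNeg : Carrier → Set ℓ
  NonNeg x = 0# < x ⊎ 0# ≈ x

  pos+nonneg : ∀ {a b} → 0# < a → NonNeg b → 0# < (a + b)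
  pos+nonneg {a} {b} 0<a (inj₂ 0≈b) =
    Order.<-respʳ-≈ (trans (sym (+-identityʳ a)) (+-cong refl 0≈b)) 0<a
  pos+nonneg {a} {b} 0<a (inj₁ 0<b) =
    Order.trans (Order.<-respʳ-≈ (sym (+-identityˡ b)) 0<b) (+-mono-< b 0<a)

  nonneg+pos : ∀ {a b} → NonNeg a → 0# < b → 0# < (a + b)
  nonneg+pos {a} {b} 0≤a 0<b = Order.<-respʳ-≈ (+-comm b a) (pos+nonneg 0<b 0≤a)

  nonneg+nonneg : ∀ {a b} → NonNeg a → NonNeg b → NonNeg (a + b)
  nonneg+nonneg 0≤a (inj₁ 0<b) = inj₁ (nonneg+pos 0≤a 0<b)
  nonneg+nonneg (inj₁ 0<a) 0≤b = inj₁ (pos+nonneg 0<a 0≤b)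
  nonneg+nonneg (inj₂ 0≈a) (inj₂ 0≈b) = inj₂ (trans (sym (+-identityʳ 0#)) (+-cong 0≈a 0≈b))

  neg-pos : ∀ {x} → x < 0# → 0# < (- x)
  neg-pos {x} x<0 = Order.<-respʳ-≈ (+-identityˡ (- x))
    (Order.<-respˡ-≈ (-‿inverseʳ x) (+-mono-< (- x) x<0))

  square-pos : ∀ x → ¬ x ≈ 0# → 0# < (x * x)
  square-pos x x≉0 with Order.compare 0# x
  ... | tri< 0<x _ _ = *-pos 0<x 0<x
  ... | tri≈ _ 0≈x _ = ⊥-elim (x≉0 (sym 0≈x))
  ... | tri> _ _ x<0 = Order.<-respʳ-≈ (-x*-x≈x*x) (*-pos (neg-pos x<0) (neg-pos x<0))
    where
    open SetoidReasoning setoid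
    -x*-x≈x*x : (- x) * (- x) ≈ x * x
    -x*-x≈x*x = begin
      (- x) * (- x) ≈⟨ -‿distribˡ-* x (- x) ⟨
      - (x * - x)   ≈⟨ -‿cong (-‿distribʳ-* x x) ⟨
      - (- (x * x)) ≈⟨ -‿involutive (x * x) ⟩
      x * x         ∎

  square-nonneg : ∀ x → NonNeg (x * x)
  square-nonneg x with x Order.≟ 0#
  ... | yes x≈0 = inj₂ (sym (trans (*-cong x≈0 x≈0) (zeroˡ 0#)))
  ... | no x≉0 = inj₁ (square-pos x x≉0)

  sum-nonneg : ∀ {k} (f : Vector Carrier k) → (∀ i → NonNeg (f i)) → NonNeg (sum f)
  sum-nonneg {zero} f f≥0 = inj₂ refl
  sum-nonneg {suc k} f f≥0 = nonneg+nonneg (f≥0 zero) (sum-nonneg (tail f) (f≥0 ∘ suc))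

  sum-pos : ∀ {k} (f : Vector Carrier k) → (∀ i → NonNeg (f i)) → ∀ j → 0# < f j → 0# < sum f
  sum-pos f f≥0 zero 0<fj = pos+nonneg 0<fj (sum-nonneg (tail f) (f≥0 ∘ suc))
  sum-pos f f≥0 (suc j) 0<fj = nonneg+pos (f≥0 zero) (sum-pos (tail f) (f≥0 ∘ suc) j 0<fj)

  sumOfSquares-zero : ∀ {k} (v : Vector Carrier k) → sum (λ i → v i * v i) ≈ 0# → ∀ i → v i ≈ 0#
  sumOfSquares-zero v Σ≈0 i with v i Order.≟ 0#
  ... | yes vᵢ≈0 = vᵢ≈0
  ... | no vᵢ≉0 = ⊥-elim (Order.irrefl refl (Order.<-respʳ-≈ Σ≈0
          (sum-pos (λ j → v j * v j) (λ j → square-nonneg (v j)) i (square-pos (v i) vᵢ≉0))))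

module Euclidean {c ℓ} (K : OrderedField c ℓ) (n : ℕ) where
  open OrderedField K hiding (zero)
  open OrderedFieldFacts K using (sumOfSquares-zero)
  open SemiringSum semiring using (sum; sum-cong-≋; sum-replicate-zero; ∑-distrib-+; ∑-comm; *-distribˡ-sum; *-distribʳ-sum)
  open RingProperties ring using (-1*x≈-x; //-rightDividesˡ; [y-z]x≈yx-zx; x[y-z]≈xy-xz)
  open VecEquality setoid using (_≋_)
  open SetoidReasoning setoid
  private module Order = IsStrictTotalOrder isStrictTotalOrder

  V : Set c
  V = Vector Carrier n

  infixl 6 _+ᵛ_ _-ᵛ_
  infixr 7 _*ᵛ_
  infix 8 _·_

  _+ᵛ_ _-ᵛ_ : V → V → V
  (u +ᵛ v) i = u i + v i
  (u -ᵛ v) i = u i - v i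

  _*ᵛ_ : Carrier → V → V
  (a *ᵛ u) i = a * u i

  _·_ : V → V → Carrier
  u · v = sum (λ i → u i * v i)

  sum-− : ∀ {k} (f g : Vector Carrier k) → sum (λ i → f i - g i) ≈ sum f - sum g
  sum-− f g = begin
    sum (λ i → f i - g i)           ≈⟨ sum-cong-≋ (λ i → +-cong refl (sym (-1*x≈-x (g i)))) ⟩
    sum (λ i → f i + - 1# * g i)    ≈⟨ ∑-distrib-+ f (λ i → - 1# * g i) ⟩
    sum f + sum (λ i → - 1# * g i)  ≈⟨ +-cong refl (*-distribˡ-sum (- 1#) g) ⟨
    sum f + - 1# * sum g            ≈⟨ +-cong refl (-1*x≈-x (sum g)) ⟩
    sum f - sum g                   ∎

  ·-cong : ∀ {u u' v v'} → u ≋ u' → v ≋ v' → u · v ≈ u' · v'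
  ·-cong u≋u' v≋v' = sum-cong-≋ (λ i → *-cong (u≋u' i) (v≋v' i))

  ·-comm : ∀ u v → u · v ≈ v · u
  ·-comm u v = sum-cong-≋ (λ i → *-comm (u i) (v i))

  ·-distrib-+ᵛ : ∀ u v w → (u +ᵛ v) · w ≈ u · w + v · w
  ·-distrib-+ᵛ u v w = trans (sum-cong-≋ (λ i → distribʳ (w i) (u i) (v i)))
                             (∑-distrib-+ (λ i → u i * w i) (λ i → v i * w i))

  ·-distribʳ-+ᵛ : ∀ w u v → w · (u +ᵛ v) ≈ w · u + w · v
  ·-distribʳ-+ᵛ w u v = trans (·-comm w (u +ᵛ v))
    (trans (·-distrib-+ᵛ u v w) (+-cong (·-comm u w) (·-comm v w)))

  ·-distrib--ᵛ : ∀ u v w → (u -ᵛ v) · w ≈ u · w - v · w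
  ·-distrib--ᵛ u v w = trans (sum-cong-≋ (λ i → [y-z]x≈yx-zx (w i) (u i) (v i)))
                             (sum-− (λ i → u i * w i) (λ i → v i * w i))

  ·-distrib-*ᵛ : ∀ a u w → (a *ᵛ u) · w ≈ a * (u · w)
  ·-distrib-*ᵛ a u w = trans (sum-cong-≋ (λ i → *-assoc a (u i) (w i)))
                             (sym (*-distribˡ-sum a (λ i → u i * w i)))

  ·-zeroʳ : ∀ u {v} → (∀ i → v i ≈ 0#) → u · v ≈ 0#
  ·-zeroʳ u {v} v≈0 = trans (sum-cong-≋ (λ i → trans (*-cong refl (v≈0 i)) (zeroʳ (u i))))
                            (sum-replicate-zero n)

  ·-self-zero : ∀ u → u · u ≈ 0# → ∀ i → u i ≈ 0#
  ·-self-zero = sumOfSquares-zero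

  comb : ∀ {k} → Vector Carrier k → (Fin k → V) → V
  comb β L i = sum (λ j → β j * L j i)

  comb-· : ∀ {k} (β : Vector Carrier k) (L : Fin k → V) w →
           comb β L · w ≈ sum (λ j → β j * (L j · w))
  comb-· β L w = begin
    sum (λ i → sum (λ j → β j * L j i) * w i)
      ≈⟨ sum-cong-≋ (λ i → *-distribʳ-sum (w i) (λ j → β j * L j i)) ⟩
    sum (λ i → sum (λ j → (β j * L j i) * w i))
      ≈⟨ ∑-comm (λ i j → (β j * L j i) * w i) ⟩
    sum (λ j → sum (λ i → (β j * L j i) * w i))
      ≈⟨ sum-cong-≋ (λ j → sum-cong-≋ (λ i → *-assoc (β j) (L j i) (w i))) ⟩
    sum (λ j → sum (λ i → β j * (L j i * w i)))
      ≈⟨ sum-cong-≋ (λ j → *-distribˡ-sum (β j) (λ i → L j i * w i)) ⟨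
    sum (λ j → β j * (L j · w)) ∎

  span-respects : ∀ {k} (L : Fin k → V) {u x} → (∀ j → u · L j ≈ x · L j) →
                  ∀ β → u · comb β L ≈ x · comb β L
  span-respects L {u} {x} agree β = begin
    u · comb β L                ≈⟨ ·-comm u (comb β L) ⟩
    comb β L · u                ≈⟨ comb-· β L u ⟩
    sum (λ j → β j * (L j · u)) ≈⟨ sum-cong-≋ (λ j → *-cong refl (flip j)) ⟩
    sum (λ j → β j * (L j · x)) ≈⟨ comb-· β L x ⟨
    comb β L · x                ≈⟨ ·-comm (comb β L) x ⟩
    x · comb β L                ∎
    where
    flip : ∀ j → L j · u ≈ L j · x
    flip j = trans (·-comm (L j) u) (trans (agree j) (·-comm x (L j)))

  NormalEquations : ∀ {k} → (Fin k → V) → V → Vector Carrier k → Set ℓ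
  NormalEquations L x β = ∀ j → comb β L · L j ≈ x · L j

  oneDimensional : ∀ (u y x : V) → Σ Carrier (λ a → y · u + a * (u · u) ≈ x · u)
  oneDimensional u y x with (u · u) Order.≟ 0#
  ... | yes u·u≈0 = 0# , (begin
    y · u + 0# * (u · u) ≈⟨ +-cong (·-zeroʳ y u≈0) (zeroˡ (u · u)) ⟩
    0# + 0#              ≈⟨ +-identityʳ 0# ⟩
    0#                   ≈⟨ ·-zeroʳ x u≈0 ⟨
    x · u                ∎)
    where
    u≈0 : ∀ i → u i ≈ 0#
    u≈0 = ·-self-zero u u·u≈0
  ... | no u·u≉0 = (x · u - y · u) * d⁻¹ , (begin
    y · u + ((x · u - y · u) * d⁻¹) * (u · u) ≈⟨ +-cong refl cancel ⟩
    y · u + (x · u - y · u)                   ≈⟨ +-comm (y · u) _ ⟩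
    (x · u - y · u) + y · u                   ≈⟨ //-rightDividesˡ (y · u) (x · u) ⟩
    x · u                                     ∎)
    where
    d⁻¹ : Carrier
    d⁻¹ = proj₁ (inverse (u · u) u·u≉0)
    cancel : ((x · u - y · u) * d⁻¹) * (u · u) ≈ x · u - y · u
    cancel = trans (*-assoc _ d⁻¹ (u · u))
      (trans (*-cong refl (trans (*-comm d⁻¹ (u · u)) (proj₂ (inverse (u · u) u·u≉0))))
             (*-identityʳ _))

  -- The residual v - p is orthogonal to L',
  -- and r = q + a(v - p), with a from oneDimensional, solves the normal
  -- equations of the whole family L for x.
  module GramSchmidtStep {k} (L : Fin (suc k) → V) (x : V)
    (γ : Vector Carrier k) (γ-normal : NormalEquations (tail L) (head L) γ)
    (δ : Vector Carrier k) (δ-normal : NormalEquations (tail L) x δ) where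

    v p q residual : V
    v = head L
    p = comb γ (tail L)
    q = comb δ (tail L)
    residual = v -ᵛ p

    a : Carrier
    a = proj₁ (oneDimensional residual q x)

    β : Vector Carrier (suc k)
    β = a Vec.∷ (λ j → δ j - a * γ j)

    residual-⊥ : ∀ j → residual · tail L j ≈ 0#
    residual-⊥ j = trans (·-distrib--ᵛ v p (tail L j))
      (trans (+-cong (sym (γ-normal j)) refl) (-‿inverseʳ (p · tail L j)))

    comb-β : comb β L ≋ q +ᵛ a *ᵛ residual
    comb-β i = begin
      a * v i + sum (λ j → (δ j - a * γ j) * tail L j i)
        ≈⟨ +-cong refl (sum-cong-≋ (λ j → [y-z]x≈yx-zx (tail L j i) (δ j) (a * γ j))) ⟩
      a * v i + sum (λ j → δ j * tail L j i - (a * γ j) * tail L j i)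
        ≈⟨ +-cong refl (sum-− (λ j → δ j * tail L j i) (λ j → (a * γ j) * tail L j i)) ⟩
      a * v i + (q i - sum (λ j → (a * γ j) * tail L j i))
        ≈⟨ +-cong refl (+-cong refl (-‿cong (trans (sum-cong-≋ (λ j → *-assoc a (γ j) (tail L j i)))
                                                    (sym (*-distribˡ-sum a (λ j → γ j * tail L j i)))))) ⟩
      a * v i + (q i - a * p i)
        ≈⟨ +-assoc (a * v i) (q i) (- (a * p i)) ⟨
      (a * v i + q i) - a * p i
        ≈⟨ +-cong (+-comm (a * v i) (q i)) refl ⟩
      (q i + a * v i) - a * p i
        ≈⟨ +-assoc (q i) (a * v i) (- (a * p i)) ⟩
      q i + (a * v i - a * p i)
        ≈⟨ +-cong refl (x[y-z]≈xy-xz a (v i) (p i)) ⟨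
      q i + a * residual i ∎

    comb-β-· : ∀ w → comb β L · w ≈ q · w + a * (residual · w)
    comb-β-· w = trans (·-cong comb-β (λ _ → refl))
      (trans (·-distrib-+ᵛ q (a *ᵛ residual) w) (+-cong refl (·-distrib-*ᵛ a residual w)))

    solves-tail : ∀ j → comb β L · tail L j ≈ x · tail L j
    solves-tail j = begin
      comb β L · tail L j                   ≈⟨ comb-β-· (tail L j) ⟩
      q · tail L j + a * (residual · tail L j) ≈⟨ +-cong refl (*-cong refl (residual-⊥ j)) ⟩
      q · tail L j + a * 0#                 ≈⟨ +-cong refl (zeroʳ a) ⟩
      q · tail L j + 0#                     ≈⟨ +-identityʳ _ ⟩
      q · tail L j                          ≈⟨ δ-normal j ⟩
      x · tail L j                          ∎

    solves-head : comb β L · v ≈ x · v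
    solves-head = begin
      comb β L · v                            ≈⟨ ·-cong (λ _ → refl) v≋residual+p ⟩
      comb β L · (residual +ᵛ p)              ≈⟨ ·-distribʳ-+ᵛ (comb β L) residual p ⟩
      comb β L · residual + comb β L · p      ≈⟨ +-cong (comb-β-· residual) (span-respects (tail L) solves-tail γ) ⟩
      (q · residual + a * (residual · residual)) + x · p
                                              ≈⟨ +-cong (proj₂ (oneDimensional residual q x)) refl ⟩
      x · residual + x · p                    ≈⟨ ·-distribʳ-+ᵛ x residual p ⟨
      x · (residual +ᵛ p)                     ≈⟨ ·-cong (λ _ → refl) v≋residual+p ⟨
      x · v                                   ∎
      where
      v≋residual+p : v ≋ residual +ᵛ p
      v≋residual+p i = sym (//-rightDividesˡ (p i) (v i))

    solves : NormalEquations L x β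
    solves zero = solves-head
    solves (suc j) = solves-tail j

  normalEquations : ∀ {k} (L : Fin k → V) (x : V) → Σ (Vector Carrier k) (NormalEquations L x)
  normalEquations {zero} L x = (λ ()) , (λ ())
  normalEquations {suc k} L x = GramSchmidtStep.β L x γ γ-normal δ δ-normal
                              , GramSchmidtStep.solves L x γ γ-normal δ δ-normal
    where
    γ δ : Vector Carrier k
    γ = proj₁ (normalEquations (tail L) (head L))
    δ = proj₁ (normalEquations (tail L) x)
    γ-normal : NormalEquations (tail L) (head L) γ
    γ-normal = proj₂ (normalEquations (tail L) (head L))
    δ-normal : NormalEquations (tail L) x δ
    δ-normal = proj₂ (normalEquations (tail L) x)

listsUpTo : ∀ {a} {A : Set a} → List A → ℕ → List (List A)
listsUpTo xs zero = [] ∷ []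
listsUpTo xs (suc n) = [] ∷ concatMap (λ x → map (x ∷_) (listsUpTo xs n)) xs

listsUpTo-complete : ∀ {a} {A : Set a} {xs : List A} → (∀ x → x ∈ xs) →
                     ∀ n ys → length ys ≤ n → ys ∈ listsUpTo xs n
listsUpTo-complete all∈ zero [] _ = here ≡.refl
listsUpTo-complete all∈ (suc n) [] _ = here ≡.refl
listsUpTo-complete {xs = xs} all∈ (suc n) (y ∷ ys) (s≤s |ys|≤n) =
  there (∈-concat⁺′ (∈-map⁺ (y ∷_) (listsUpTo-complete all∈ n ys |ys|≤n))
                    (∈-map⁺ (λ x → map (x ∷_) (listsUpTo xs n)) (all∈ y)))

lookup-injective : ∀ {a} {A : Set a} {xs : List A} → Unique xs →
                   ∀ {i j} → lookup xs i ≡ lookup xs j → i ≡ j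
lookup-injective (_ ∷ _) {zero} {zero} _ = ≡.refl
lookup-injective (x∉ ∷ _) {zero} {suc j} eq = ⊥-elim (AllP.lookup x∉ (∈-lookup j) eq)
lookup-injective (x∉ ∷ _) {suc i} {zero} eq = ⊥-elim (AllP.lookup x∉ (∈-lookup i) (≡.sym eq))
lookup-injective (_ ∷ unique) {suc i} {suc j} eq = ≡.cong suc (lookup-injective unique eq)

unique-length : ∀ {m} (xs : List (Fin m)) → Unique xs → length xs ≤ m
unique-length xs unique = FinP.injective⇒≤ (lookup-injective unique)

module CycleEnumeration (G : Multigraph) where
  open Multigraph G

  walk? : ∀ u ss v → Dec (Walk u ss v)
  walk? u [] v with u Fin.≟ v
  ... | yes ≡.refl = yes nil
  ... | no u≢v = no λ { nil → u≢v ≡.refl }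
  walk? u (s ∷ ss) v with u Fin.≟ stepTail s
  ... | no u≢tail = no λ { (cons _) → u≢tail ≡.refl }
  ... | yes ≡.refl with walk? (stepHead s) ss v
  ...   | yes w = yes (cons w)
  ...   | no ¬w = no λ { (cons w) → ¬w w }

  CycleOn : List (Step nE) → Set
  CycleOn ss = Σ Cycle (λ C → Cycle.steps C ≡ ss)

  -- being a cycle is decidable; a closed walk may be based at its first step
  cycleOn? : ∀ ss → Dec (CycleOn ss)
  cycleOn? [] = no λ { (C , ≡.refl) → tooShort (Cycle.nontriv C) }
    where
    tooShort : ¬ 2 ≤ 0
    tooShort ()
  cycleOn? (s ∷ ss) = map′ build unbuild
    (2 ≤? length (s ∷ ss) ×-dec walk? (stepTail s) (s ∷ ss) (stepTail s)
      ×-dec VertexUnique.unique? (map stepTail (s ∷ ss)) ×-dec EdgeUnique.unique? (map proj₁ (s ∷ ss)))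
    where
    module VertexUnique = DecUnique (Fin._≟_ {nV})
    module EdgeUnique = DecUnique (Fin._≟_ {nE})
    Fields : Set
    Fields = 2 ≤ length (s ∷ ss) × Walk (stepTail s) (s ∷ ss) (stepTail s)
           × Unique (map stepTail (s ∷ ss)) × Unique (map proj₁ (s ∷ ss))
    build : Fields → CycleOn (s ∷ ss)
    build (nontriv , closed , distinctV , distinctE) =
      record { steps = s ∷ ss ; nontriv = nontriv ; base = stepTail s ; closed = closed
             ; distinctV = distinctV ; distinctE = distinctE } , ≡.refl
    unbuild : CycleOn (s ∷ ss) → Fields
    unbuild (record { steps = _ ; nontriv = nontriv ; base = _ ; closed = cons w
                    ; distinctV = distinctV ; distinctE = distinctE } , ≡.refl) =
      nontriv , cons w , distinctV , distinctE

  toCycle : List (Step nE) → Maybe Cycle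
  toCycle ss with cycleOn? ss
  ... | yes (C , _) = just C
  ... | no _ = nothing

  toCycle-complete : ∀ C → MaybeAny.Any (λ C' → Cycle.steps C' ≡ Cycle.steps C) (toCycle (Cycle.steps C))
  toCycle-complete C with cycleOn? (Cycle.steps C)
  ... | yes (C' , eq) = MaybeAny.just eq
  ... | no ¬cycle = ⊥-elim (¬cycle (C , ≡.refl))

  allSteps : List (Step nE)
  allSteps = cartesianProduct (allFin nE) (true ∷ false ∷ [])

  allSteps-complete : ∀ s → s ∈ allSteps
  allSteps-complete (e , b) = ∈-cartesianProduct⁺ (∈-allFin e) (bool∈ b)
    where
    bool∈ : ∀ b → b ∈ true ∷ false ∷ []
    bool∈ true = here ≡.refl
    bool∈ false = there (here ≡.refl)

  -- a cycle uses each edge at most once, so it has at most nE steps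
  cycle-length : ∀ C → length (Cycle.steps C) ≤ nE
  cycle-length C = ≡.subst (_≤ nE) (length-map proj₁ (Cycle.steps C))
    (unique-length (map proj₁ (Cycle.steps C)) (Cycle.distinctE C))

  cycles : List Cycle
  cycles = mapMaybe toCycle (listsUpTo allSteps nE)

  cycles-complete : ∀ C → Any (λ C' → Cycle.steps C' ≡ Cycle.steps C) cycles
  cycles-complete C = AnyP.mapMaybe⁺ toCycle (listsUpTo allSteps nE)
    (AnyP.map⁺ (Any.map (λ { ≡.refl → toCycle-complete C })
      (listsUpTo-complete allSteps-complete nE (Cycle.steps C) (cycle-length C))))

module CycleSpace {c ℓ} (K : OrderedField c ℓ) (G : Multigraph) where
  open OrderedField K hiding (zero)
  open Multigraph G using (nE; Cycle)
  open OverField K G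
  open Euclidean K nE
  open CycleEnumeration G using (cycles; cycles-complete)
  open SemiringSum semiring using (sum; sum-cong-≋; sum-replicate-zero)
  open SetoidReasoning setoid
  private module Order = IsStrictTotalOrder isStrictTotalOrder

  sumFin≡sum : ∀ {k} (f : Vector Carrier k) → sumFin f ≡ sum f
  sumFin≡sum {zero} f = ≡.refl
  sumFin≡sum {suc k} f = ≡.cong (f zero +_) (sumFin≡sum (tail f))

  ⟨⟩≡· : ∀ u v → ⟨ u , v ⟩ ≡ u · v
  ⟨⟩≡· u v = sumFin≡sum (λ e → u e * v e)

  sumList-tabulate : ∀ {a} {A : Set a} {k} (f : A → Carrier) (g : Fin k → A) →
                     sumList f (tabulate g) ≡ sum (f ∘ g)
  sumList-tabulate {k = zero} f g = ≡.refl
  sumList-tabulate {k = suc k} f g = ≡.cong (f (g zero) +_) (sumList-tabulate f (g ∘ suc))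

  cycleVec-steps : ∀ C C' → Cycle.steps C ≡ Cycle.steps C' → ∀ e → cycleVec C e ≡ cycleVec C' e
  cycleVec-steps _ _ eq e = ≡.cong (sumList _) eq

  projectionOntoH₁ : ∀ x → Σ V (λ w → InH₁ w × (∀ C → ⟨ w , cycleVec C ⟩ ≈ ⟨ x , cycleVec C ⟩))
  projectionOntoH₁ x = comb β L , (terms , w-expansion) , agree
    where
    L : Fin (length cycles) → V
    L i = cycleVec (lookup cycles i)
    β : Vector Carrier (length cycles)
    β = proj₁ (normalEquations L x)
    terms : List (Carrier × Cycle)
    terms = tabulate (λ i → β i , lookup cycles i)
    w-expansion : ∀ e → comb β L e ≈ sumList (λ t → proj₁ t * cycleVec (proj₂ t) e) terms
    w-expansion e = reflexive (≡.sym (sumList-tabulate (λ t → proj₁ t * cycleVec (proj₂ t) e)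
                                                        (λ i → β i , lookup cycles i)))
    agree : ∀ C → ⟨ comb β L , cycleVec C ⟩ ≈ ⟨ x , cycleVec C ⟩
    agree C = begin
      ⟨ comb β L , cycleVec C ⟩ ≡⟨ ⟨⟩≡· (comb β L) (cycleVec C) ⟩
      comb β L · cycleVec C     ≈⟨ ·-cong (λ _ → refl) Lᵢ≋C ⟨
      comb β L · L i            ≈⟨ proj₂ (normalEquations L x) i ⟩
      x · L i                   ≈⟨ ·-cong (λ _ → refl) Lᵢ≋C ⟩
      x · cycleVec C            ≡⟨ ⟨⟩≡· x (cycleVec C) ⟨
      ⟨ x , cycleVec C ⟩        ∎
      where
      i : Fin (length cycles)
      i = index (cycles-complete C)
      Lᵢ≋C : ∀ e → L i e ≈ cycleVec C e
      Lᵢ≋C e = reflexive (cycleVec-steps (lookup cycles i) C (lookup-index (cycles-complete C)) e)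

  geometric-ofPairing : ∀ x (Chosen : Cycle → Set ℓ) →
                        (∀ C → Chosen C → 0# < ⟨ x , cycleVec C ⟩) → Geometric Chosen
  geometric-ofPairing x Chosen positive = w , w∈H₁ , λ C chosen →
    Order.<-respʳ-≈ (sym (agrees C)) (positive C chosen)
    where
    w : V
    w = proj₁ (projectionOntoH₁ x)
    w∈H₁ : InH₁ w
    w∈H₁ = proj₁ (proj₂ (projectionOntoH₁ x))
    agrees : ∀ C → ⟨ w , cycleVec C ⟩ ≈ ⟨ x , cycleVec C ⟩
    agrees = proj₂ (proj₂ (projectionOntoH₁ x))

  sum-indicator : ∀ {k} (u : Vector Carrier k) f x →
                  sum (λ e → u e * (if does (f Fin.≟ e) then x else 0#)) ≈ u f * x
  sum-indicator {suc k} u zero x = trans (+-cong refl rest≈0) (+-identityʳ (u zero * x))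
    where
    rest≈0 : sum (λ e → u (suc e) * 0#) ≈ 0#
    rest≈0 = trans (sum-cong-≋ (λ e → zeroʳ (u (suc e)))) (sum-replicate-zero k)
  sum-indicator {suc k} u (suc f) x =
    trans (+-cong (zeroʳ (u zero)) (sum-indicator (tail u) f x)) (+-identityˡ (u (suc f) * x))

  extendByZero : (Fin nE → Bool) → V → V
  extendByZero F α e = if F e then 0# else α e

  pairing-offForestWeight : ∀ F α C → ⟨ extendByZero F α , cycleVec C ⟩ ≈ offForestWeight F α C
  pairing-offForestWeight F α C = trans (reflexive (⟨⟩≡· ᾱ (cycleVec C))) (alongSteps (Cycle.steps C))
    where
    ᾱ : V
    ᾱ = extendByZero F α
    indicator : Step nE → V
    indicator s e = if does (proj₁ s Fin.≟ e) then signK (proj₂ s) else 0#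
    summand : Step nE → Carrier
    summand s = if F (proj₁ s) then 0# else signK (proj₂ s) * α (proj₁ s)
    oneStep : ∀ s → ᾱ · indicator s ≈ summand s
    oneStep (f , b) with F f | sum-indicator ᾱ f (signK b)
    ... | true | ᾱ·ind≈ = trans ᾱ·ind≈ (zeroˡ (signK b))
    ... | false | ᾱ·ind≈ = trans ᾱ·ind≈ (*-comm (α f) (signK b))
    alongSteps : ∀ ss → ᾱ · (λ e → sumList (λ s → indicator s e) ss) ≈ sumList summand ss
    alongSteps [] = ·-zeroʳ ᾱ (λ _ → refl)
    alongSteps (s ∷ ss) = trans (·-distribʳ-+ᵛ ᾱ (indicator s) _) (+-cong (oneStep s) (alongSteps ss))

corollary3p7 : ∀ {c ℓ : Level} (K : OrderedField c ℓ) (G : Multigraph) →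
    Multigraph.Connected G →
    (F : Fin (Multigraph.nE G) → Bool) → Multigraph.IsForest G F →
    (α : Fin (Multigraph.nE G) → OrderedField.Carrier K) →
    (∀ C → ¬ (OrderedField._≈_ K (OverField.offForestWeight K G F α C) (OrderedField.0# K))) →
    OverField.Geometric K G
      (λ C → OrderedField._<_ K (OrderedField.0# K) (OverField.offForestWeight K G F α C))
corollary3p7 K G _ F _ α _ = geometric-ofPairing (extendByZero F α) _ ᾱ-positive
  where
  open OrderedField K
  open OverField K G
  open CycleSpace K G
  module Order = IsStrictTotalOrder isStrictTotalOrder
  ᾱ-positive : ∀ C → 0# < offForestWeight F α C → 0# < ⟨ extendByZero F α , cycleVec C ⟩
  ᾱ-positive C = Order.<-respʳ-≈ (sym (pairing-offForestWeight F α C))
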